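{- Let $x_1,\dots,x_N$ be a sequence of positive integers such that $(x_1,x_2)\neq(2,1)$ and $x_{i+1}=x_i\pm 1$ for all $i=1,\dots,N-1$. If $N\ge(\max_{1\le i\le N}x_i)^2$, then the sequence can be partitioned into proper chunks.
   Context: For a sequence $x_1,\dots,x_N$, a chunk is a consecutive subsequence $x_i,x_{i+1},\dots,x_j$ with $1\le i\le j\le N$, of length $j-i+1$. A chunk is proper if some element equals its length, i.e. $x_k=j-i+1$ for some $k\in\{i,\dots,j\}$. Partitioning the sequence into proper chunks means writing it as a concatenation of consecutive proper chunks. -}

module Defs where

open import Data.Nat using (ℕ; zero; suc; _⊔_; _<_)
open import Data.List using (List; []; _∷_; length; concat; foldr)
open import Data.List.Relation.Unary.All using (All)
open import Data.List.Membership.Propositional using (_∈_)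
open import Data.Product using (_×_)
open import Data.Sum using (_⊎_)
open import Data.Empty using (⊥)
open import Data.Unit using (⊤)
open import Relation.Binary.PropositionalEquality using (_≡_)

maxList : List ℕ → ℕ
maxList = foldr _⊔_ 0

StepsPM1 : List ℕ → Set
StepsPM1 []           = ⊤
StepsPM1 (x ∷ [])     = ⊤
StepsPM1 (x ∷ y ∷ xs) = (y ≡ suc x ⊎ suc y ≡ x) × StepsPM1 (y ∷ xs)

NotStart21 : List ℕ → Set
NotStart21 (2 ∷ 1 ∷ _) = ⊥
NotStart21 _           = ⊤

-- a chunk is proper if it is nonempty and some element equals its length
-- (nonemptiness is automatic: length 0 is not an element of the empty list)
Proper : List ℕ → Set
Proper c = length c ∈ c

record ProperPartition (xs : List ℕ) : Set where
  field
    chunks  : List (List ℕ)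
    concat≡ : concat chunks ≡ xs
    proper  : All Proper chunks

-- Call c a cut point when the first c terms split into proper chunks. If c is a cut point and
-- some term in [c, c + L) equals L, then c + L is a cut point, so a window a, …, a + t of cut
-- points moves forward by L whenever some x j = L has a + t ≤ j < a + L. Let e = a + t. If
-- x e ≤ t + 1, the term x e closes a chunk ending right after e and the window grows by one.
-- Otherwise x e and x (e + 1) are L and L + 1 in some order, and unless they form the descent
-- (t + 2, t + 1) the windows moved by L and by L + 1 overlap in a window of t + 2 cut points
-- starting at most M further on. The descent is settled by an intermediate value argument when
-- t ≥ 1, and cannot occur at t = 0 because (x₁, x₂) ≠ (2, 1). After M − 1 widenings, M² ≤ N
-- leaves room for a window of M cut points; from there on every term, being at most M, closes a
-- chunk ending right after it, so N is a cut point.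
{-# OPTIONS --safe #-}
module Submission where

open import Defs
open import Data.Nat
  using (ℕ; zero; suc; _+_; _*_; _∸_; _⊓_; _≤_; _<_; _≤′_; ≤′-refl; ≤′-step; z≤n; s≤s; _≤?_)
open import Data.Nat.Properties
open import Data.Nat.Tactic.RingSolver using (solve-∀)
open import Data.List using (List; []; _∷_; [_]; length; take; drop; _++_; concat)
open import Data.List.Properties
  using (concat-++; ++-identityʳ; take-all; take-[]; length-take; length-drop)
open import Data.List.Relation.Unary.All as All using (All; []; _∷_)
open import Data.List.Relation.Unary.All.Properties using (++⁺)
open import Data.List.Relation.Unary.Any using (here; there)
open import Data.List.Membership.Propositional using (_∈_)
open import Data.Product using (∃; _×_; _,_)
open import Data.Sum using (_⊎_; inj₁; inj₂)
open import Data.Empty using (⊥; ⊥-elim)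
open import Relation.Nullary using (yes; no; contradiction)
open import Relation.Binary.PropositionalEquality
  using (_≡_; refl; sym; trans; cong; cong₂; subst; module ≡-Reasoning)

+-suc-suc : ∀ m n → m + suc (suc n) ≡ suc (suc (m + n))
+-suc-suc m n = trans (+-suc m (suc n)) (cong suc (+-suc m n))

intermediate-value : (f : ℕ → ℕ) {a b t : ℕ} → (∀ i → i < b → f (suc i) ≤ suc (f i)) →
                     a ≤′ b → f a ≤ t → t ≤ f b → ∃ λ j → a ≤ j × j ≤ b × f j ≡ t
intermediate-value f slow ≤′-refl lo hi = _ , ≤-refl , ≤-refl , ≤-antisym lo hi
intermediate-value f {b = suc b} {t} slow (≤′-step a≤′b) lo hi with t ≤? f b
... | yes t≤fb with intermediate-value f (λ i i<b → slow i (m<n⇒m<1+n i<b)) a≤′b lo t≤fb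
...   | j , a≤j , j≤b , fj≡t = j , a≤j , m≤n⇒m≤1+n j≤b , fj≡t
intermediate-value f {b = suc b} {t} slow (≤′-step a≤′b) lo hi | no t≰fb =
  suc b , ≤′⇒≤ (≤′-step a≤′b) , ≤-refl , ≤-antisym (≤-trans (slow b ≤-refl) (≰⇒> t≰fb)) hi

-- Positions are 0-based: Cut x N c says that x 0, …, x (c ∸ 1) split into proper chunks.
data Cut (x : ℕ → ℕ) (N : ℕ) : ℕ → Set where
  start : Cut x N 0
  chunk : ∀ {c} j → Cut x N c → c ≤ j → j < c + x j → c + x j ≤ N → Cut x N (c + x j)

module CutPoints (x : ℕ → ℕ) (N : ℕ) where

  cut-chunk : ∀ {c d} j → Cut x N c → c ≤ j → j < d → c + x j ≡ d → d ≤ N → Cut x N d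
  cut-chunk j cut c≤j j<d refl d≤N = chunk j cut c≤j j<d d≤N

  Window : ℕ → ℕ → Set
  Window a s = ∀ k → k < s → Cut x N (a + k)

  window-start : Window 0 1
  window-start zero    _         = start
  window-start (suc k) (s≤s ())

  window-snoc : ∀ {a s} → Window a s → Cut x N (a + s) → Window a (suc s)
  window-snoc w cut k k≤s with m≤n⇒m<n∨m≡n (≤-pred k≤s)
  ... | inj₁ k<s  = w k k<s
  ... | inj₂ refl = cut

  window-tail : ∀ {a s} → Window a (suc s) → Window (suc a) s
  window-tail {a} w k k<s = subst (Cut x N) (+-suc a k) (w (suc k) (s≤s k<s))

  window-overlap : ∀ {a s} → Window a (suc s) → Window (suc a) (suc s) → Window a (suc (suc s))
  window-overlap {a} {s} w w′ = window-snoc w (subst (Cut x N) (sym (+-suc a s)) (w′ s ≤-refl))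

  window-translate : ∀ {a b t} j → Window a (suc t) → a + t ≤ j → j < b → a + x j ≡ b →
                     b + t ≤ N → Window b (suc t)
  window-translate {a} {b} j w a+t≤j j<b a+xj≡b b+t≤N k k≤t =
    cut-chunk j (w k k≤t) (≤-trans (+-monoʳ-≤ a (≤-pred k≤t)) a+t≤j) (<-≤-trans j<b (m≤m+n b k))
      (trans (swap a k (x j)) (cong (_+ k) a+xj≡b)) (≤-trans (+-monoʳ-≤ b (≤-pred k≤t)) b+t≤N)
    where
      swap : ∀ a k l → a + k + l ≡ a + l + k
      swap = solve-∀

  next-cut : ∀ {b t} → Window b (suc t) → 1 ≤ x (b + t) → x (b + t) ≤ suc t → b + suc t ≤ N →
             Cut x N (b + suc t)
  next-cut {b} {t} w 1≤v v≤1+t fit =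
    cut-chunk (b + t) (w o (s≤s o≤t)) (+-monoʳ-≤ b o≤t) (+-monoʳ-< b (n<1+n t))
      (trans (+-assoc b o (x (b + t))) (cong (b +_) (m∸n+n≡m v≤1+t))) fit
    where
      o : ℕ
      o = suc t ∸ x (b + t)
      o≤t : o ≤ t
      o≤t = ∸-monoʳ-≤ (suc t) 1≤v

  Widening : ℕ → ℕ → ℕ → Set
  Widening a t M = ∃ λ a′ → a′ ≤ a + M × Window a′ (suc (suc t))

  widen-by-pair : ∀ {a t M L} i i′ → Window a (suc t) → suc (suc t) ≤ L → suc L ≤ M →
                  a + t + suc M ≤ N →
                  a + t ≤ i  → i  ≤ suc (a + t) → x i  ≡ L →
                  a + t ≤ i′ → i′ ≤ suc (a + t) → x i′ ≡ suc L →
                  Widening a t M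
  widen-by-pair {a} {t} {M} {L} i i′ w 2+t≤L 1+L≤M fit e≤i i≤1+e x[i]≡L e≤i′ i′≤1+e x[i′]≡1+L =
    a + L , +-monoʳ-≤ a (<⇒≤ 1+L≤M) ,
    window-overlap
      (window-translate i w e≤i (before i≤1+e) (cong (a +_) x[i]≡L) (≤-trans (n≤1+n _) fit′))
      (window-translate i′ w e≤i′ (m<n⇒m<1+n (before i′≤1+e))
        (trans (cong (a +_) x[i′]≡1+L) (+-suc a L)) fit′)
    where
      shuffle : ∀ a t L → a + t + suc L ≡ suc (a + L + t)
      shuffle = solve-∀
      before : ∀ {j} → j ≤ suc (a + t) → j < a + L
      before j≤1+e = <-≤-trans (s≤s j≤1+e) (subst (_≤ a + L) (+-suc-suc a t) (+-monoʳ-≤ a 2+t≤L))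
      fit′ : suc (a + L) + t ≤ N
      fit′ = subst (_≤ N) (shuffle a t L) (≤-trans (+-monoʳ-≤ (a + t) (m≤n⇒m≤1+n 1+L≤M)) fit)

  module _ (positive : ∀ i → i < N → 1 ≤ x i)
           (steps : ∀ i → suc i < N → x (suc i) ≡ suc (x i) ⊎ suc (x (suc i)) ≡ x i) where

    crossing : ∀ {a b t} → b < N → a ≤ b → x a ≤ t → t ≤ x b → ∃ λ j → a ≤ j × j ≤ b × x j ≡ t
    crossing b<N a≤b = intermediate-value x slow (≤⇒≤′ a≤b)
      where
        slow : ∀ i → i < _ → x (suc i) ≤ suc (x i)
        slow i i<b with steps i (<-≤-trans (s≤s i<b) b<N)
        ... | inj₁ up   = ≤-reflexive up
        ... | inj₂ down = ≤-trans (n≤1+n _) (≤-trans (≤-reflexive down) (n≤1+n _))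

    -- The chunk closed by b + t + 1 has length x (b + t) if that is at most t + 1, and is
    -- otherwise [e, b + t] of length t + 3 or [b, b + t] of length t + 1: starting from
    -- x (e + 1) = t + 1, the terms up to b + t must reach t + 3 or come back to t + 1.
    next-cut-after-descent : ∀ {e t} → 1 ≤ t → Cut x N e → x (suc e) ≡ suc t →
                             Window (suc (suc e)) (suc t) → suc (suc e) + suc t ≤ N →
                             Cut x N (suc (suc e) + suc t)
    next-cut-after-descent {e} {t} 1≤t cut-e x[1+e]≡1+t w fit = close
      where
        b : ℕ
        b = suc (suc e)
        within : ∀ {j} → j ≤ b + t → j < b + suc t
        within j≤b+t = ≤-<-trans j≤b+t (+-monoʳ-< b (n<1+n t))
        b+t<N : b + t < N
        b+t<N = <-≤-trans (within ≤-refl) fit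
        1+b≤b+t : suc b ≤ b + t
        1+b≤b+t = s≤s (s≤s (subst (_≤ e + t) (+-comm e 1) (+-monoʳ-≤ e 1≤t)))
        from-e : ∀ j → suc e ≤ j → j ≤ b + t → x j ≡ suc (suc (suc t)) → Cut x N (b + suc t)
        from-e j 1+e≤j j≤b+t x[j]≡3+t =
          cut-chunk j cut-e (<⇒≤ 1+e≤j) (within j≤b+t)
            (trans (cong (e +_) x[j]≡3+t) (shift e t)) fit
          where
            shift : ∀ e t → e + suc (suc (suc t)) ≡ suc (suc e) + suc t
            shift = solve-∀
        from-b : ∀ j → b ≤ j → j ≤ b + t → x j ≡ suc t → Cut x N (b + suc t)
        from-b j b≤j j≤b+t x[j]≡1+t =
          cut-chunk j (subst (Cut x N) (+-identityʳ b) (w 0 (s≤s z≤n))) b≤j (within j≤b+t)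
            (cong (b +_) x[j]≡1+t) fit
        after-rise : x b ≡ suc (suc t) → Cut x N (b + suc t)
        after-rise x[b]≡2+t with steps b (≤-<-trans 1+b≤b+t b+t<N)
        ... | inj₁ up   =
          from-e (suc b) (s≤s (m≤n⇒m≤1+n (n≤1+n e))) 1+b≤b+t (trans up (cong suc x[b]≡2+t))
        ... | inj₂ down =
          from-b (suc b) (n≤1+n b) 1+b≤b+t (suc-injective (trans down x[b]≡2+t))
        close : Cut x N (b + suc t)
        close with x (b + t) ≤? suc t
        ... | yes low = next-cut w (positive (b + t) b+t<N) low fit
        ... | no ¬low with steps (suc e) (≤-<-trans (m≤m+n b t) b+t<N)
        ...   | inj₁ up   = after-rise (trans up (cong suc x[1+e]≡1+t))
        ...   | inj₂ down =
          let x[b]≤1+t = ≤-trans (≤-reflexive (suc-injective (trans down x[1+e]≡1+t))) (n≤1+n t)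
              j , b≤j , j≤b+t , x[j]≡1+t = crossing b+t<N (m≤m+n b t) x[b]≤1+t (<⇒≤ (≰⇒> ¬low))
          in from-b j b≤j j≤b+t x[j]≡1+t

    widen-at-descent : ∀ {a t M} → Window a (suc t) → suc (suc t) ≤ M → a + t + suc M ≤ N →
                       1 ≤ t → x (a + t) ≡ suc (suc t) → x (suc (a + t)) ≡ suc t → Widening a t M
    widen-at-descent {a} {t} {M} w 2+t≤M fit 1≤t x[e]≡2+t x[1+e]≡1+t =
      suc (suc e) , subst (_≤ a + M) (+-suc-suc a t) (+-monoʳ-≤ a 2+t≤M) ,
      window-snoc w′ (next-cut-after-descent 1≤t (w t ≤-refl) x[1+e]≡1+t w′ fit′)
      where
        e : ℕ
        e = a + t
        shuffle : ∀ e t → suc (suc e) + suc t ≡ e + suc (suc (suc t))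
        shuffle = solve-∀
        fit′ : suc (suc e) + suc t ≤ N
        fit′ = subst (_≤ N) (sym (shuffle e t)) (≤-trans (+-monoʳ-≤ e (s≤s 2+t≤M)) fit)
        w′ : Window (suc (suc e)) (suc t)
        w′ = window-translate e w ≤-refl (m<n⇒m<1+n (n<1+n e))
               (trans (cong (a +_) x[e]≡2+t) (+-suc-suc a t))
               (≤-trans (+-monoʳ-≤ (suc (suc e)) (n≤1+n t)) fit′)

    window-widen : ∀ {a t M} → (∀ i → i < N → x i ≤ M) → Window a (suc t) → suc (suc t) ≤ M →
                   a + t + suc M ≤ N → (x (a + t) ≡ suc (suc t) → x (suc (a + t)) ≡ suc t → 1 ≤ t) →
                   Widening a t M
    window-widen {a} {t} {M} bounded w 2+t≤M fit descent⇒1≤t = widened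
      where
        e : ℕ
        e = a + t
        1+e<N : suc e < N
        1+e<N = ≤-trans (≤-reflexive (+-comm 2 e))
                  (≤-trans (+-monoʳ-≤ e (m≤n⇒m≤1+n (≤-trans (s≤s (s≤s z≤n)) 2+t≤M))) fit)
        e<N : e < N
        e<N = <⇒≤ 1+e<N
        widened : Widening a t M
        widened with x e ≤? suc t
        ... | yes low = a , m≤m+n a M ,
          window-snoc w (next-cut w (positive e e<N) low (subst (_≤ N) (sym (+-suc a t)) e<N))
        ... | no ¬low with steps e 1+e<N
        ...   | inj₁ up =
          widen-by-pair e (suc e) w (≰⇒> ¬low) (subst (_≤ M) up (bounded (suc e) 1+e<N)) fit
            ≤-refl (n≤1+n e) refl (n≤1+n e) ≤-refl up
        ...   | inj₂ down with x (suc e) ≤? suc t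
        ...     | no ¬low′ =
          widen-by-pair (suc e) e w (≰⇒> ¬low′) (subst (_≤ M) (sym down) (bounded e e<N)) fit
            (n≤1+n e) ≤-refl refl ≤-refl (n≤1+n e) (sym down)
        ...     | yes low′ =
          let x[1+e]≡1+t = ≤-antisym low′ (≤-pred (subst (suc (suc t) ≤_) (sym down) (≰⇒> ¬low)))
              x[e]≡2+t   = trans (sym down) (cong suc x[1+e]≡1+t)
          in widen-at-descent w 2+t≤M fit (descent⇒1≤t x[e]≡2+t x[1+e]≡1+t) x[e]≡2+t x[1+e]≡1+t

    window-reaches-end : ∀ {s} → (∀ i → i < N → x i ≤ suc s) →
                         ∀ n b → Window b (suc s) → b + s + n ≡ N → Cut x N N
    window-reaches-end {s} bounded zero b w b+s+0≡N =
      subst (Cut x N) (trans (sym (+-identityʳ (b + s))) b+s+0≡N) (w s ≤-refl)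
    window-reaches-end {s} bounded (suc n) b w b+s+1+n≡N =
      window-reaches-end bounded n (suc b) (window-tail (window-snoc w next))
        (trans (sym (+-suc (b + s) n)) b+s+1+n≡N)
      where
        b+s<N : b + s < N
        b+s<N = subst (b + s <_) b+s+1+n≡N (m<m+n (b + s) (s≤s z≤n))
        next : Cut x N (b + suc s)
        next = next-cut w (positive (b + s) b+s<N) (bounded (b + s) b+s<N)
                 (subst (_≤ N) (sym (+-suc b s)) b+s<N)

    module _ {m : ℕ} (bounded : ∀ i → i < N → x i ≤ suc m) (square≤N : suc m * suc m ≤ N)
             (no-start21 : x 0 ≡ 2 → x 1 ≡ 1 → ⊥) where

      widening-fits : ∀ {a t} → a ≤ t * suc m → suc t ≤ m → a + t + suc (suc m) ≤ N
      widening-fits {a} {t} a≤tM 1+t≤m = begin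
        a + t + suc (suc m)          ≤⟨ +-monoˡ-≤ (suc (suc m)) (+-monoˡ-≤ t a≤tM) ⟩
        t * suc m + t + suc (suc m)  ≡⟨ expand t m ⟩
        suc t * suc (suc m)          ≤⟨ *-monoˡ-≤ (suc (suc m)) 1+t≤m ⟩
        m * suc (suc m)              <⟨ ≤-reflexive (below-square m) ⟩
        suc m * suc m                ≤⟨ square≤N ⟩
        N                            ∎
        where
          open ≤-Reasoning
          expand : ∀ t m → t * suc m + t + suc (suc m) ≡ suc t * suc (suc m)
          expand = solve-∀
          below-square : ∀ m → suc (m * suc (suc m)) ≡ suc m * suc m
          below-square = solve-∀

      -- At t = 0 the bound forces a = 0, so the descent would be (x 0, x 1) = (2, 1).
      descent⇒1≤t : ∀ {a} t → a ≤ t * suc m →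
                    x (a + t) ≡ suc (suc t) → x (suc (a + t)) ≡ suc t → 1 ≤ t
      descent⇒1≤t zero    z≤n x[0]≡2 x[1]≡1 = ⊥-elim (no-start21 x[0]≡2 x[1]≡1)
      descent⇒1≤t (suc t) _   _      _      = s≤s z≤n

      window-of-size : ∀ t → t ≤ m → ∃ λ a → a ≤ t * suc m × Window a (suc t)
      window-of-size zero    _      = 0 , z≤n , window-start
      window-of-size (suc t) 1+t≤m =
        let a , a≤tM , w = window-of-size t (<⇒≤ 1+t≤m)
            a′ , a′≤a+M , w′ = window-widen bounded w (s≤s 1+t≤m) (widening-fits a≤tM 1+t≤m)
                                 (descent⇒1≤t t a≤tM)
            a+M≤[1+t]M = ≤-trans (+-monoˡ-≤ (suc m) a≤tM) (≤-reflexive (+-comm (t * suc m) (suc m)))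
        in a′ , ≤-trans a′≤a+M a+M≤[1+t]M , w′

    end-is-cut : ∀ M → (∀ i → i < N → x i ≤ M) → M * M ≤ N → (x 0 ≡ 2 → x 1 ≡ 1 → ⊥) → 0 < N →
                 Cut x N N
    end-is-cut zero    bounded _        _          0<N =
      contradiction (≤-trans (positive 0 0<N) (bounded 0 0<N)) λ ()
    end-is-cut (suc m) bounded square≤N no-start21 _ =
      let a , a≤mM , w = window-of-size bounded square≤N no-start21 m ≤-refl
          a+m<N = ≤-trans (s≤s (+-monoˡ-≤ m a≤mM)) (≤-trans (≤-reflexive (square m)) square≤N)
          n , a+m+n≡N = m≤n⇒∃[o]m+o≡n (<⇒≤ a+m<N)
      in window-reaches-end bounded n a w a+m+n≡N
      where
        square : ∀ m → suc (m * suc m + m) ≡ suc m * suc m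
        square = solve-∀

el : List ℕ → ℕ → ℕ
el []       _       = 0
el (y ∷ ys) zero    = y
el (y ∷ ys) (suc i) = el ys i

el-∈ : ∀ xs {i} → i < length xs → el xs i ∈ xs
el-∈ (y ∷ ys) {zero}  _          = here refl
el-∈ (y ∷ ys) {suc i} (s≤s i<n) = there (el-∈ ys i<n)

el-All : ∀ {P : ℕ → Set} {xs} → All P xs → ∀ i → i < length xs → P (el xs i)
el-All {xs = xs} ps i i<n = All.lookup ps (el-∈ xs i<n)

el-∈-slice : ∀ xs {c L j} → c ≤ j → j < c + L → j < length xs → el xs j ∈ take L (drop c xs)
el-∈-slice (y ∷ ys) {zero}  {suc L} {zero}  _          _           _         = here refl
el-∈-slice (y ∷ ys) {zero}  {suc L} {suc j} _          (s≤s j<L)   (s≤s j<n) =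
  there (el-∈-slice ys z≤n j<L j<n)
el-∈-slice (y ∷ ys) {suc c} {L}     {suc j} (s≤s c≤j) (s≤s j<c+L) (s≤s j<n) =
  el-∈-slice ys c≤j j<c+L j<n

length-slice : ∀ (xs : List ℕ) {c L} → c + L ≤ length xs → length (take L (drop c xs)) ≡ L
length-slice xs {c} {L} c+L≤n = begin
  length (take L (drop c xs))  ≡⟨ length-take L (drop c xs) ⟩
  L ⊓ length (drop c xs)       ≡⟨ cong (L ⊓_) (length-drop c xs) ⟩
  L ⊓ (length xs ∸ c)          ≡⟨ m≤n⇒m⊓n≡m L≤n∸c ⟩
  L                            ∎
  where
    open ≡-Reasoning
    L≤n∸c : L ≤ length xs ∸ c
    L≤n∸c = m+n≤o⇒m≤o∸n L (subst (_≤ length xs) (+-comm c L) c+L≤n)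

take-+ : ∀ {A : Set} c L (xs : List A) → take (c + L) xs ≡ take c xs ++ take L (drop c xs)
take-+ zero    L xs       = refl
take-+ (suc c) L []       = sym (take-[] L)
take-+ (suc c) L (y ∷ ys) = cong (y ∷_) (take-+ c L ys)

≤-maxList : ∀ xs → All (_≤ maxList xs) xs
≤-maxList []       = []
≤-maxList (y ∷ ys) =
  m≤m⊔n y (maxList ys) ∷ All.map (λ z≤max → ≤-trans z≤max (m≤n⊔m y (maxList ys))) (≤-maxList ys)

el-steps : ∀ {xs} → StepsPM1 xs → ∀ i → suc i < length xs →
           el xs (suc i) ≡ suc (el xs i) ⊎ suc (el xs (suc i)) ≡ el xs i
el-steps {_ ∷ []}    _              i       (s≤s ())
el-steps {_ ∷ _ ∷ _} (±1 , _)       zero    _         = ±1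
el-steps {_ ∷ _ ∷ _} (_  , steps)   (suc i) (s≤s i<n) = el-steps steps i i<n

el-not-start21 : ∀ {xs} → NotStart21 xs → el xs 0 ≡ 2 → el xs 1 ≡ 1 → ⊥
el-not-start21 {_ ∷ _ ∷ _} ns refl refl = ns

empty-partition : ProperPartition []
empty-partition = record { chunks = [] ; concat≡ = refl ; proper = [] }

partition-snoc : ∀ {ys c} → ProperPartition ys → Proper c → ProperPartition (ys ++ c)
partition-snoc {ys} {c} p proper-c = record
  { chunks  = chunks ++ [ c ]
  ; concat≡ = begin
      concat (chunks ++ [ c ])    ≡⟨ concat-++ chunks [ c ] ⟨
      concat chunks ++ c ++ []    ≡⟨ cong₂ _++_ concat≡ (++-identityʳ c) ⟩
      ys ++ c                     ∎
  ; proper  = ++⁺ proper (proper-c ∷ [])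
  }
  where
    open ProperPartition p
    open ≡-Reasoning

partition-prefix : ∀ xs {c} → Cut (el xs) (length xs) c → ProperPartition (take c xs)
partition-prefix xs start = empty-partition
partition-prefix xs (chunk {c} j cut c≤j j<end end≤n) =
  subst ProperPartition (sym (take-+ c (el xs j) xs))
    (partition-snoc (partition-prefix xs cut) proper)
  where
    slice : List ℕ
    slice = take (el xs j) (drop c xs)
    proper : Proper slice
    proper = subst (_∈ slice) (sym (length-slice xs end≤n))
               (el-∈-slice xs c≤j j<end (<-≤-trans j<end end≤n))

lemma3p2 : (xs : List ℕ) → All (0 <_) xs → NotStart21 xs → StepsPM1 xs →
    maxList xs * maxList xs ≤ length xs → ProperPartition xs
lemma3p2 []         _        _  _     _        = empty-partition
lemma3p2 xs@(_ ∷ _) positive ns steps square≤N =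
  subst ProperPartition (take-all (length xs) xs ≤-refl) (partition-prefix xs end)
  where
    end : Cut (el xs) (length xs) (length xs)
    end = CutPoints.end-is-cut (el xs) (length xs) (el-All positive) (el-steps steps)
            (maxList xs) (el-All (≤-maxList xs)) square≤N (el-not-start21 ns) (s≤s z≤n)
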